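{- An algebra $\mathbf{A}=\langle A,\vee,*,\neg_r,\neg_l,0,1\rangle$ of type $\langle 2,2,1,1,0,0\rangle$ belongs to $\mathbb{PM}^{sl}$ if and only if it satisfies: (1) a set of equations defining semilatticed monoids (i.e. $\langle A,\vee\rangle$ is a semilattice, $\langle A,*,1\rangle$ is a monoid, and $x*(y\vee z)\approx(x*y)\vee(x*z)$, $(y\vee z)*x\approx(y*x)\vee(z*x)$); (2) the equations $\neg_r 1\approx 0$, $1\vee\neg_r 0\approx\neg_r 0$, $(x*\neg_r(y*x))\vee\neg_r y\approx\neg_r y$, $\neg_l 1\approx 0$, $1\vee\neg_l 0\approx\neg_l 0$, $((\neg_l(x*y))*x)\vee\neg_l y\approx\neg_l y$; and (3) the equations $\neg_r(x\vee y)\vee\neg_r x\approx\neg_r x$ and $\neg_l(x\vee y)\vee\neg_l x\approx\neg_l x$. In particular, $\mathbb{PM}^{sl}$ is a variety.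
   Context: $\mathbb{PM}^{sl}$ is the class of algebras $\langle A,\vee,*,\neg_r,\neg_l,0,1\rangle$ such that $\langle A,\vee\rangle$ is a join-semilattice, $\langle A,*,1\rangle$ is a monoid, $*$ distributes over $\vee$ on both sides, $0$ is an arbitrary element, and, writing $a\le b$ for $a\vee b=b$, for all $a,b\in A$: $a*b\le0$ iff $b\le\neg_r a$ iff $a\le\neg_l b$. -}

module Defs where

open import Level using (Level; _⊔_; suc)
open import Data.Product using (_×_)
open import Relation.Binary.PropositionalEquality using (_≡_)
open import Function.Bundles using (_⇔_)

record Algebra (ℓ : Level) : Set (suc ℓ) where
  field
    Carrier : Set ℓ
    _∨_     : Carrier → Carrier → Carrier
    _*_     : Carrier → Carrier → Carrier
    ¬r      : Carrier → Carrier
    ¬l      : Carrier → Carrier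
    𝟘       : Carrier
    𝟙       : Carrier

  infixl 6 _∨_
  infixl 7 _*_
  infix 4 _≤_

  _≤_ : Carrier → Carrier → Set ℓ
  a ≤ b = (a ∨ b) ≡ b

module _ {ℓ : Level} (𝐀 : Algebra ℓ) where
  open Algebra 𝐀

  IsSemilatticedMonoid : Set ℓ
  IsSemilatticedMonoid =
    (∀ x y z → (x ∨ y) ∨ z ≡ x ∨ (y ∨ z)) ×
    (∀ x y → x ∨ y ≡ y ∨ x) ×
    (∀ x → x ∨ x ≡ x) ×
    (∀ x y z → (x * y) * z ≡ x * (y * z)) ×
    (∀ x → 𝟙 * x ≡ x) ×
    (∀ x → x * 𝟙 ≡ x) ×
    (∀ x y z → x * (y ∨ z) ≡ (x * y) ∨ (x * z)) ×
    (∀ x y z → (y ∨ z) * x ≡ (y * x) ∨ (z * x))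

  IsPMsl : Set ℓ
  IsPMsl =
    IsSemilatticedMonoid ×
    (∀ a b → ((a * b ≤ 𝟘) ⇔ (b ≤ ¬r a)) × ((b ≤ ¬r a) ⇔ (a ≤ ¬l b)))

  NegationEquations : Set ℓ
  NegationEquations =
    (¬r 𝟙 ≡ 𝟘) ×
    (𝟙 ∨ ¬r 𝟘 ≡ ¬r 𝟘) ×
    (∀ x y → (x * ¬r (y * x)) ∨ ¬r y ≡ ¬r y) ×
    (¬l 𝟙 ≡ 𝟘) ×
    (𝟙 ∨ ¬l 𝟘 ≡ ¬l 𝟘) ×
    (∀ x y → ((¬l (x * y)) * x) ∨ ¬l y ≡ ¬l y)

  AntitoneEquations : Set ℓ
  AntitoneEquations =
    (∀ x y → ¬r (x ∨ y) ∨ ¬r x ≡ ¬r x) ×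
    (∀ x y → ¬l (x ∨ y) ∨ ¬l x ≡ ¬l x)

  SatisfiesPMslEquations : Set ℓ
  SatisfiesPMslEquations =
    IsSemilatticedMonoid × NegationEquations × AntitoneEquations

-- Both sides split into a half about ¬r and a half about ¬l, and the ¬l half
-- is the ¬r half of the opposite algebra (reversed *, ¬r and ¬l swapped).
-- For ¬r, residuation a * b ≤ 0 ⇔ b ≤ ¬r a amounts to antitonicity of ¬r plus
-- the counit a * ¬r a ≤ 0, which is the third equation at y = 1, and
-- b = b * 1 ≤ b * ¬r 0 ≤ b * ¬r (a * b) ≤ ¬r a whenever a * b ≤ 0.
module Submission where

open import Defs
open import Level using (Level)
open import Data.Product using (_×_; _,_)
open import Function.Bundles using (_⇔_; mk⇔; Equivalence)
import Function.Properties.Equivalence as ⇔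
open import Relation.Binary.PropositionalEquality

module SemilatticedMonoidOrder {ℓ : Level} (𝐀 : Algebra ℓ) (S : IsSemilatticedMonoid 𝐀) where
  open Algebra 𝐀

  private
    ∨-assoc : ∀ x y z → (x ∨ y) ∨ z ≡ x ∨ (y ∨ z)
    ∨-comm  : ∀ x y → x ∨ y ≡ y ∨ x
    ∨-idem  : ∀ x → x ∨ x ≡ x
    *-distribˡ-∨ : ∀ x y z → x * (y ∨ z) ≡ (x * y) ∨ (x * z)
    *-distribʳ-∨ : ∀ x y z → (y ∨ z) * x ≡ (y * x) ∨ (z * x)
    ∨-assoc = let (p , _) = S in p
    ∨-comm  = let (_ , p , _) = S in p
    ∨-idem  = let (_ , _ , p , _) = S in p
    *-distribˡ-∨ = let (_ , _ , _ , _ , _ , _ , p , _) = S in p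
    *-distribʳ-∨ = let (_ , _ , _ , _ , _ , _ , _ , p) = S in p

  ≤-refl : ∀ x → x ≤ x
  ≤-refl = ∨-idem

  ≤-reflexive : ∀ {x y} → x ≡ y → x ≤ y
  ≤-reflexive {x} refl = ≤-refl x

  ≤-trans : ∀ {x y z} → x ≤ y → y ≤ z → x ≤ z
  ≤-trans {x} {y} {z} x≤y y≤z = begin
    x ∨ z        ≡⟨ cong (x ∨_) (sym y≤z) ⟩
    x ∨ (y ∨ z)  ≡⟨ sym (∨-assoc x y z) ⟩
    (x ∨ y) ∨ z  ≡⟨ cong (_∨ z) x≤y ⟩
    y ∨ z        ≡⟨ y≤z ⟩
    z            ∎
    where open ≡-Reasoning

  ≤-antisym : ∀ {x y} → x ≤ y → y ≤ x → x ≡ y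
  ≤-antisym {x} {y} x≤y y≤x = trans (sym y≤x) (trans (∨-comm y x) x≤y)

  x≤x∨y : ∀ x y → x ≤ x ∨ y
  x≤x∨y x y = trans (sym (∨-assoc x x y)) (cong (_∨ y) (∨-idem x))

  *-monoʳ-≤ : ∀ z {x y} → x ≤ y → z * x ≤ z * y
  *-monoʳ-≤ z {x} {y} x≤y = trans (sym (*-distribˡ-∨ z x y)) (cong (z *_) x≤y)

  *-monoˡ-≤ : ∀ z {x y} → x ≤ y → x * z ≤ y * z
  *-monoˡ-≤ z {x} {y} x≤y = trans (sym (*-distribʳ-∨ z x y)) (cong (_* z) x≤y)

opposite : {ℓ : Level} → Algebra ℓ → Algebra ℓ
opposite 𝐀 = record
  { Carrier = Carrier
  ; _∨_     = _∨_
  ; _*_     = λ x y → y * x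
  ; ¬r      = ¬l
  ; ¬l      = ¬r
  ; 𝟘       = 𝟘
  ; 𝟙       = 𝟙
  }
  where open Algebra 𝐀

opposite-isSemilatticedMonoid : {ℓ : Level} (𝐀 : Algebra ℓ) →
                                IsSemilatticedMonoid 𝐀 → IsSemilatticedMonoid (opposite 𝐀)
opposite-isSemilatticedMonoid 𝐀
  (∨-assoc , ∨-comm , ∨-idem , *-assoc , *-identityˡ , *-identityʳ , *-distribˡ-∨ , *-distribʳ-∨) =
  ∨-assoc , ∨-comm , ∨-idem , (λ x y z → sym (*-assoc z y x)) ,
  *-identityʳ , *-identityˡ , *-distribʳ-∨ , *-distribˡ-∨

module _ {ℓ : Level} (𝐀 : Algebra ℓ) where
  open Algebra 𝐀

  RightResiduated : Set ℓ
  RightResiduated = ∀ a b → (a * b ≤ 𝟘) ⇔ (b ≤ ¬r a)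

  RightNegationEquations : Set ℓ
  RightNegationEquations =
    (¬r 𝟙 ≡ 𝟘) ×
    (𝟙 ≤ ¬r 𝟘) ×
    (∀ x y → x * ¬r (y * x) ≤ ¬r y) ×
    (∀ x y → ¬r (x ∨ y) ≤ ¬r x)

module _ {ℓ : Level} (𝐀 : Algebra ℓ) (S : IsSemilatticedMonoid 𝐀) where
  open Algebra 𝐀
  open SemilatticedMonoidOrder 𝐀 S

  private
    *-assoc : ∀ x y z → (x * y) * z ≡ x * (y * z)
    *-identityˡ : ∀ x → 𝟙 * x ≡ x
    *-identityʳ : ∀ x → x * 𝟙 ≡ x
    *-assoc = let (_ , _ , _ , p , _) = S in p
    *-identityˡ = let (_ , _ , _ , _ , p , _) = S in p
    *-identityʳ = let (_ , _ , _ , _ , _ , p , _) = S in p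

  rightResiduated⇒rightNegationEquations : RightResiduated 𝐀 → RightNegationEquations 𝐀
  rightResiduated⇒rightNegationEquations res =
    ¬r𝟙≡𝟘 , residual (≤-reflexive (*-identityʳ 𝟘)) , ¬r-shift , ¬r-antitone
    where
    residual : ∀ {a b} → a * b ≤ 𝟘 → b ≤ ¬r a
    residual {a} {b} = Equivalence.to (res a b)

    counit : ∀ a → a * ¬r a ≤ 𝟘
    counit a = Equivalence.from (res a (¬r a)) (≤-refl (¬r a))

    ¬r𝟙≡𝟘 : ¬r 𝟙 ≡ 𝟘
    ¬r𝟙≡𝟘 = ≤-antisym (subst (_≤ 𝟘) (*-identityˡ (¬r 𝟙)) (counit 𝟙))
                      (residual (≤-reflexive (*-identityˡ 𝟘)))

    ¬r-shift : ∀ x y → x * ¬r (y * x) ≤ ¬r y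
    ¬r-shift x y = residual (subst (_≤ 𝟘) (*-assoc y x _) (counit (y * x)))

    ¬r-antitone : ∀ x y → ¬r (x ∨ y) ≤ ¬r x
    ¬r-antitone x y = residual (≤-trans (*-monoˡ-≤ (¬r (x ∨ y)) (x≤x∨y x y)) (counit (x ∨ y)))

  rightNegationEquations⇒rightResiduated : RightNegationEquations 𝐀 → RightResiduated 𝐀
  rightNegationEquations⇒rightResiduated (¬r𝟙≡𝟘 , 𝟙≤¬r𝟘 , ¬r-shift , ¬r-antitone) a b =
    mk⇔ residual (λ b≤¬ra → ≤-trans (*-monoʳ-≤ a b≤¬ra) (counit a))
    where
    ¬r-mono : ∀ {x y} → x ≤ y → ¬r y ≤ ¬r x
    ¬r-mono {x} x≤y = subst (λ t → ¬r t ≤ ¬r x) x≤y (¬r-antitone x _)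

    counit : ∀ a → a * ¬r a ≤ 𝟘
    counit a = subst₂ (λ u v → a * ¬r u ≤ v) (*-identityˡ a) ¬r𝟙≡𝟘 (¬r-shift a 𝟙)

    residual : a * b ≤ 𝟘 → b ≤ ¬r a
    residual ab≤𝟘 =
      ≤-trans (≤-reflexive (sym (*-identityʳ b)))
        (≤-trans (*-monoʳ-≤ b (≤-trans 𝟙≤¬r𝟘 (¬r-mono ab≤𝟘)))
                 (¬r-shift b a))

  rightResiduated⇔rightNegationEquations : RightResiduated 𝐀 ⇔ RightNegationEquations 𝐀
  rightResiduated⇔rightNegationEquations =
    mk⇔ rightResiduated⇒rightNegationEquations rightNegationEquations⇒rightResiduated

module _ {ℓ : Level} (𝐀 : Algebra ℓ) where
  isPMsl⇔residuatedOnBothSides :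
    IsPMsl 𝐀 ⇔ (IsSemilatticedMonoid 𝐀 × RightResiduated 𝐀 × RightResiduated (opposite 𝐀))
  isPMsl⇔residuatedOnBothSides = mk⇔
    (λ (S , res) → S , (λ a b → let (r , _) = res a b in r)
                     , (λ a b → let (r , l) = res b a in ⇔.trans r l))
    (λ (S , right , left) → S , λ a b → right a b , ⇔.trans (⇔.sym (right a b)) (left b a))

  satisfiesPMslEquations⇔negationEquationsOnBothSides :
    SatisfiesPMslEquations 𝐀 ⇔
    (IsSemilatticedMonoid 𝐀 × RightNegationEquations 𝐀 × RightNegationEquations (opposite 𝐀))
  satisfiesPMslEquations⇔negationEquationsOnBothSides = mk⇔
    (λ (S , (r₁ , r₂ , r₃ , l₁ , l₂ , l₃) , (r₄ , l₄)) →
       S , (r₁ , r₂ , r₃ , r₄) , (l₁ , l₂ , l₃ , l₄))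
    (λ (S , (r₁ , r₂ , r₃ , r₄) , (l₁ , l₂ , l₃ , l₄)) →
       S , (r₁ , r₂ , r₃ , l₁ , l₂ , l₃) , (r₄ , l₄))

  residuatedOnBothSides⇔negationEquationsOnBothSides :
    (IsSemilatticedMonoid 𝐀 × RightResiduated 𝐀 × RightResiduated (opposite 𝐀)) ⇔
    (IsSemilatticedMonoid 𝐀 × RightNegationEquations 𝐀 × RightNegationEquations (opposite 𝐀))
  residuatedOnBothSides⇔negationEquationsOnBothSides = mk⇔
    (λ (S , right , left) → S , Equivalence.to (rightSide S) right , Equivalence.to (leftSide S) left)
    (λ (S , right , left) → S , Equivalence.from (rightSide S) right , Equivalence.from (leftSide S) left)
    where
    rightSide : (S : IsSemilatticedMonoid 𝐀) → RightResiduated 𝐀 ⇔ RightNegationEquations 𝐀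
    rightSide S = rightResiduated⇔rightNegationEquations 𝐀 S

    leftSide : IsSemilatticedMonoid 𝐀 →
               RightResiduated (opposite 𝐀) ⇔ RightNegationEquations (opposite 𝐀)
    leftSide S = rightResiduated⇔rightNegationEquations (opposite 𝐀) (opposite-isSemilatticedMonoid 𝐀 S)

theorem16 : {ℓ : Level} (𝐀 : Algebra ℓ) → IsPMsl 𝐀 ⇔ SatisfiesPMslEquations 𝐀
theorem16 𝐀 =
  ⇔.trans (isPMsl⇔residuatedOnBothSides 𝐀)
    (⇔.trans (residuatedOnBothSides⇔negationEquationsOnBothSides 𝐀)
      (⇔.sym (satisfiesPMslEquations⇔negationEquationsOnBothSides 𝐀)))
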